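{- Let $G$ be a digraph and $r\geq 1$. Then the distance-$r$ VC-dimension of $G$ is bounded by $(r+2)\cdot(2\,\mathrm{wcol}_r(G))^2$.
   Context: For a family $\mathcal{F}\subseteq 2^A$, a set $X\subseteq A$ is shattered if $\{X\cap F: F\in\mathcal{F}\}=2^X$; the VC-dimension of $\mathcal{F}$ is the maximum size of a shattered set. $N_r^-(v)$ is the set of vertices $u$ such that $G$ has a directed path of length at most $r$ from $u$ to $v$. The distance-$r$ VC-dimension of $G$ is the VC-dimension of the family $\{N_r^-(v): v\in V(G)\}$ over ground set $V(G)$. Weak coloring numbers: for a linear order $L$ of $V(G)$, $u$ is weakly $r$-reachable from $v$ w.r.t. $L$ if there is a directed path $P$ of length at most $r$ between $u$ and $v$ (in either direction) such that $u$ is the $L$-minimum vertex of $P$; $\mathrm{WReach}_r[G,L,v]$ is the set of such $u$ (including $v$); $\mathrm{wcol}_r(G)=\min_L\max_{v}|\mathrm{WReach}_r[G,L,v]|$ over linear orders $L$ of $V(G)$. -}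

module Defs where

open import Level using (0ℓ)
open import Data.Nat using (ℕ; _≤_)
open import Data.Fin using (Fin) renaming (_≤_ to _≤ᶠ_)
open import Data.Fin.Subset using (Subset; _∈_; _⊆_; ∣_∣)
open import Data.Fin.Permutation using (Permutation′; _⟨$⟩ʳ_)
open import Data.List using (List; []; _∷_; length)
open import Data.List.Relation.Unary.All using (All)
open import Data.List.Relation.Unary.Linked using (Linked)
open import Data.List.Relation.Unary.Unique.Propositional using (Unique)
open import Data.Product using (Σ; ∃; _×_)
open import Data.Sum using (_⊎_)
open import Relation.Binary using (Rel)
open import Relation.Binary.PropositionalEquality using (_≡_)
open import Relation.Nullary using (¬_)

-- A (finite) digraph on vertex set Fin n is given by its edge relation E:
-- E u w means there is an arc u → w.
Digraph : ℕ → Set₁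
Digraph n = Rel (Fin n) 0ℓ

lastOf : ∀ {n} → Fin n → List (Fin n) → Fin n
lastOf x []       = x
lastOf x (y ∷ ys) = lastOf y ys

record DiPath {n} (E : Digraph n) (u v : Fin n) : Set where
  field
    rest   : List (Fin n)
    linked : Linked E (u ∷ rest)
    unique : Unique (u ∷ rest)
    ends   : lastOf u rest ≡ v

open DiPath public

pathVertices : ∀ {n} {E : Digraph n} {u v : Fin n} → DiPath E u v → List (Fin n)
pathVertices {u = u} P = u ∷ rest P

pathLength : ∀ {n} {E : Digraph n} {u v : Fin n} → DiPath E u v → ℕ
pathLength P = length (rest P)

-- u ∈ N_r^-(v): there is a directed path of length ≤ r from u to v
InNbr⁻ : ∀ {n} → Digraph n → ℕ → Fin n → Fin n → Set
InNbr⁻ E r v u = Σ (DiPath E u v) λ P → pathLength P ≤ r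

Shattered : ∀ {n} → Digraph n → ℕ → Subset n → Set
Shattered {n} E r X =
  ∀ (Y : Subset n) → Y ⊆ X →
    ∃ λ (v : Fin n) → ∀ (x : Fin n) → x ∈ X → ((x ∈ Y → InNbr⁻ E r v x) × (InNbr⁻ E r v x → x ∈ Y))

-- Linear orders of V(G) = Fin n, represented by a permutation L giving the position
-- of each vertex; u ≤_L w iff L u ≤ L w.
LinOrder : ℕ → Set
LinOrder n = Permutation′ n

_≤[_]_ : ∀ {n} → Fin n → LinOrder n → Fin n → Set
u ≤[ L ] w = (L ⟨$⟩ʳ u) ≤ᶠ (L ⟨$⟩ʳ w)

WReach : ∀ {n} → Digraph n → LinOrder n → ℕ → Fin n → Fin n → Set
WReach E L r v u =
    (Σ (DiPath E u v) λ P → pathLength P ≤ r × All (λ w → u ≤[ L ] w) (pathVertices P))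
  ⊎ (Σ (DiPath E v u) λ P → pathLength P ≤ r × All (λ w → u ≤[ L ] w) (pathVertices P))

-- |S| ≤ c for a set S ⊆ Fin n given as a predicate: every duplicate-free list of
-- elements of S has length at most c.
CardAtMost : ∀ {n} → (Fin n → Set) → ℕ → Set
CardAtMost {n} S c = ∀ (xs : List (Fin n)) → Unique xs → All S xs → length xs ≤ c

WcolAtMost : ∀ {n} → Digraph n → ℕ → ℕ → Set
WcolAtMost {n} E r c = ∃ λ (L : LinOrder n) → ∀ (v : Fin n) → CardAtMost (WReach E L r v) c

module Submission where

-- Idea: let L witness wcol_r(G) ≤ c and let ξ : Fin d → X enumerate d vertices of a
-- shattered set X.  Call m a hub if some ξ j reaches m by a path of length ≤ r on which m
-- is L-minimal; such m lie in WReach_r[ξ j], so there are at most d·c hubs.  Every path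
-- x → v of length ≤ r splits at its L-minimal vertex m into x → m and m → v, with m
-- L-minimal on both halves.  Hence, for x among the ξ j, membership x ∈ N⁻_r(v) is
-- decided by the code of v: the list of (hub m, least length of such an m → v path) for
-- the ≤ c hubs m ∈ WReach_r[v].  Shattering makes S ↦ code(vertex cutting out ξ[S])
-- injective, so 2^d ≤ (1 + d·c·(r+1))^c, which fails for d = bound + 1.
--
-- Path existence is
-- not decidable for an arbitrary arc relation, so the argument runs under the double
-- negation of the needed decisions, which is harmless because the conclusion is decidable.

open import Defs
open import Level using (0ℓ)
open import Data.Nat using (ℕ; zero; suc; _≤_; _<_; _+_; _*_; _^_; _∸_; z≤n; s≤s; _≤?_)
open import Data.Nat.Properties
  using (≤-refl; ≤-trans; ≤-reflexive; n≤1+n; m≤m+n; +-mono-≤; +-monoʳ-≤; *-mono-≤; *-monoʳ-≤;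
         *-monoˡ-≤; *-assoc; m≤m*n; ^-monoˡ-≤; ^-monoʳ-<; ^-*-assoc; n<1+n; <⇒≱; ≰⇒>;
         m+n≤o⇒m≤o; m+n≤o⇒n≤o; m+n≤o⇒m≤o∸n; m∸n+n≡m; module ≤-Reasoning)
open import Data.Nat.Tactic.RingSolver using (solve-∀)
open import Data.Fin using (Fin; zero; suc; toℕ; fromℕ; fromℕ<; inject≤; combine; remQuot)
open import Data.Fin.Properties
  using (suc-injective; toℕ-fromℕ; toℕ-fromℕ<; toℕ≤pred[n]; inject≤-injective; combine-injective;
         combine-injectiveˡ; combine-remQuot; injective⇒≤; 2↔Bool; ≤-totalOrder; any?)
  renaming (_≟_ to _≟ᶠ_)
open import Data.Fin.Subset using (Subset; ∣_∣; inside; outside)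
  renaming (_∈_ to _∈ₛ_; _⊆_ to _⊆ₛ_)
open import Data.Fin.Subset.Properties using (⊆-antisym) renaming (_∈?_ to _∈ₛ?_)
open import Data.Fin.Permutation using (_⟨$⟩ʳ_)
open import Data.List using (List; []; _∷_; length; _++_; filter; concatMap; allFin; lookup)
open import Data.List.Properties using (length-++; length-tabulate)
open import Data.List.Membership.Propositional using (_∈_; _∉_; mapWith∈; lose)
open import Data.List.Membership.Propositional.Properties
  using (∈-filter⁺; ∈-filter⁻; ∈-allFin; ∈-concatMap⁺)
open import Data.List.Relation.Binary.Subset.Propositional using (_⊆_)
open import Data.List.Relation.Unary.Any using (here; there; index)
open import Data.List.Relation.Unary.Any.Properties using (lookup-index; mapWith∈⁺; mapWith∈⁻)
open import Data.List.Relation.Unary.All using (All; []; _∷_) renaming (tabulate to tabulateAll)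
open import Data.List.Relation.Unary.All.Properties using (¬Any⇒All¬; anti-mono)
open import Data.List.Relation.Unary.Linked using (Linked; [-]; _∷_)
open import Data.List.Relation.Unary.AllPairs using ([]; _∷_)
open import Data.List.Relation.Unary.Unique.Propositional.Properties using (filter⁺; allFin⁺)
import Data.List.Extrema as Extrema
open import Data.Vec using (_∷_; []; tabulate)
import Data.Vec as Vec
open import Data.Vec.Properties using (lookup∘tabulate; []=⇒lookup; lookup⇒[]=)
open import Data.Product using (Σ; ∃; ∃-syntax; _×_; _,_; proj₁; proj₂; uncurry)
open import Data.Sum using (inj₁; inj₂)
open import Function using (_∘_; id; Inverse)
open import Function.Definitions using (Injective)
open import Relation.Binary.PropositionalEquality
  using (_≡_; refl; sym; trans; cong; cong₂; subst)
open import Relation.Nullary using (¬_; Dec; yes; no; does; proof; contradiction)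
open import Relation.Nullary.Decidable using (_×-dec_; dec-true; decidable-stable; ¬¬-excluded-middle)
open import Relation.Nullary.Reflects using (Reflects; invert)
open import Relation.Unary using (Pred; Decidable)

-- MinPath E L m s t b: a path s → t with at most b arcs all of whose vertices are L-above m.
-- WReach E L r v u is exactly MinPath E L u u v r ⊎ MinPath E L u v u r.
MinPath : ∀ {n} → Digraph n → LinOrder n → (m s t : Fin n) → ℕ → Set
MinPath E L m s t b = Σ (DiPath E s t) λ P → pathLength P ≤ b × All (m ≤[ L ]_) (pathVertices P)

minPath-mono : ∀ {n} {E : Digraph n} L m {s t b b′} → b ≤ b′ →
               MinPath E L m s t b → MinPath E L m s t b′
minPath-mono _ _ b≤b′ (P , P≤b , P≥m) = P , ≤-trans P≤b b≤b′ , P≥m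

minPath⇒inNbr : ∀ {n} {E : Digraph n} L m {s t b} → MinPath E L m s t b → InNbr⁻ E b t s
minPath⇒inNbr _ _ (P , P≤b , _) = P , P≤b

inNbr-mono : ∀ {n} {E : Digraph n} {a b v x} → a ≤ b → InNbr⁻ E a v x → InNbr⁻ E b v x
inNbr-mono a≤b (P , P≤a) = P , ≤-trans P≤a a≤b

module Paths {n} (E : Digraph n) where

  open import Data.List.Membership.DecPropositional (_≟ᶠ_ {n}) using (_∈?_)

  record Walk (u v : Fin n) : Set where
    constructor walk
    field
      visits  : List (Fin n)
      joined  : Linked E (u ∷ visits)
      arrives : lastOf u visits ≡ v
  open Walk

  walkLength : ∀ {u v} → Walk u v → ℕ
  walkLength W = length (visits W)

  walkVertices : ∀ {u v} → Walk u v → List (Fin n)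
  walkVertices {u} W = u ∷ visits W

  pathWalk : ∀ {u v} → DiPath E u v → Walk u v
  pathWalk P = walk (rest P) (linked P) (ends P)

  linked-++ : ∀ (x : Fin n) xs {y} ys → Linked E (x ∷ xs) → lastOf x xs ≡ y → Linked E (y ∷ ys) →
              Linked E (x ∷ xs ++ ys)
  linked-++ x []       ys _        refl l₂ = l₂
  linked-++ x (w ∷ xs) ys (e ∷ l₁) eq   l₂ = e ∷ linked-++ w xs ys l₁ eq l₂

  lastOf-++ : ∀ (x : Fin n) xs {y} ys → lastOf x xs ≡ y → lastOf x (xs ++ ys) ≡ lastOf y ys
  lastOf-++ x []       ys refl = refl
  lastOf-++ x (w ∷ xs) ys eq   = lastOf-++ w xs ys eq

  _++ᵂ_ : ∀ {x m v} → Walk x m → Walk m v → Walk x v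
  _++ᵂ_ {x} W₁ W₂ = walk (visits W₁ ++ visits W₂)
    (linked-++ x (visits W₁) (visits W₂) (joined W₁) (arrives W₁) (joined W₂))
    (trans (lastOf-++ x (visits W₁) (visits W₂) (arrives W₁)) (arrives W₂))

  record SplitAt {u v} (W : Walk u v) (z : Fin n) : Set where
    field
      before   : Walk u z
      after    : Walk z v
      lengths  : walkLength before + walkLength after ≡ walkLength W
      before⊆W : walkVertices before ⊆ walkVertices W
      after⊆W  : walkVertices after ⊆ walkVertices W

  splitWalk : ∀ {u v z} (W : Walk u v) → z ∈ walkVertices W → SplitAt W z
  splitWalk W (here refl) = record
    { before = walk [] [-] refl ; after = W ; lengths = refl
    ; before⊆W = λ { (here p) → here p } ; after⊆W = id }
  splitWalk (walk (y ∷ ys) (e ∷ l) end) (there z∈) = record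
    { before   = walk (y ∷ visits before) (e ∷ joined before) (arrives before)
    ; after    = after
    ; lengths  = cong suc lengths
    ; before⊆W = λ { (here p) → here p ; (there q) → there (before⊆W q) }
    ; after⊆W  = there ∘ after⊆W }
    where open SplitAt (splitWalk (walk ys l end) z∈)

  record PathWithin (u v : Fin n) (ℓ : ℕ) (vs : List (Fin n)) : Set where
    constructor within
    field
      path   : DiPath E u v
      short  : pathLength path ≤ ℓ
      stays  : pathVertices path ⊆ vs

  relax : ∀ {u v ℓ ℓ′ vs ws} → ℓ ≤ ℓ′ → vs ⊆ ws → PathWithin u v ℓ vs → PathWithin u v ℓ′ ws
  relax ℓ≤ℓ′ vs⊆ws (within P P≤ℓ P⊆vs) = within P (≤-trans P≤ℓ ℓ≤ℓ′) (vs⊆ws ∘ P⊆vs)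

  suffix : ∀ {y u v} (P : DiPath E y v) → u ∈ pathVertices P →
           PathWithin u v (pathLength P) (pathVertices P)
  suffix P (here refl) = within P ≤-refl id
  suffix record { rest = w ∷ ws ; linked = _ ∷ l ; unique = _ ∷ un ; ends = end } (there u∈) =
    relax (n≤1+n _) there (suffix (record { rest = ws ; linked = l ; unique = un ; ends = end }) u∈)

  prepend : ∀ {u y v} → E u y → (P : DiPath E y v) → u ∉ pathVertices P → DiPath E u v
  prepend e P u∉P = record
    { rest = pathVertices P ; linked = e ∷ linked P
    ; unique = ¬Any⇒All¬ _ u∉P ∷ unique P ; ends = ends P }

  -- Every walk contains a path between its endpoints: cut out the cycle at each repeat.
  walkToPath : ∀ {u v} (W : Walk u v) → PathWithin u v (walkLength W) (walkVertices W)
  walkToPath (walk [] _ refl) =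
    within (record { rest = [] ; linked = [-] ; unique = [] ∷ [] ; ends = refl }) z≤n id
  walkToPath {u} (walk (y ∷ ys) (e ∷ l) end) with walkToPath (walk ys l end)
  ... | within P P≤ P⊆ with u ∈? pathVertices P
  ...   | yes u∈P = relax (≤-trans P≤ (n≤1+n _)) (there ∘ P⊆) (suffix P u∈P)
  ...   | no  u∉P =
    within (prepend e P u∉P) (s≤s P≤) λ { (here p) → here p ; (there q) → there (P⊆ q) }

  inNbr-trans : ∀ {a b x m v} → InNbr⁻ E a m x → InNbr⁻ E b v m → InNbr⁻ E (a + b) v x
  inNbr-trans (P , P≤a) (Q , Q≤b) with walkToPath (pathWalk P ++ᵂ pathWalk Q)
  ... | within R R≤ _ =
    R , ≤-trans R≤ (≤-trans (≤-reflexive (length-++ (rest P))) (+-mono-≤ P≤a Q≤b))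

  record PivotSplit (L : LinOrder n) (x v : Fin n) (r : ℕ) : Set where
    field
      pivot  : Fin n
      a b    : ℕ
      a+b≤r  : a + b ≤ r
      first  : MinPath E L pivot x pivot a
      second : MinPath E L pivot pivot v b

  module _ (L : LinOrder n) where
    open Extrema (≤-totalOrder n) using (argmin; argmin-sel; f[argmin]≤f[⊤]; f[argmin]≤f[xs])

    lowest : Fin n → List (Fin n) → Fin n
    lowest = argmin (L ⟨$⟩ʳ_)

    lowest-∈ : ∀ x xs → lowest x xs ∈ x ∷ xs
    lowest-∈ x xs with argmin-sel (L ⟨$⟩ʳ_) x xs
    ... | inj₁ eq = here eq
    ... | inj₂ ∈xs = there ∈xs

    lowest-≤ : ∀ x xs → All (lowest x xs ≤[ L ]_) (x ∷ xs)
    lowest-≤ x xs = f[argmin]≤f[⊤] {f = L ⟨$⟩ʳ_} x xs ∷ f[argmin]≤f[xs] {f = L ⟨$⟩ʳ_} x xs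

    minSplit : ∀ {r x v} → InNbr⁻ E r v x → PivotSplit L x v r
    minSplit {r} {x} {v} (P , P≤r) = split (splitWalk (pathWalk P) (lowest-∈ x (rest P)))
      where
      m : Fin n
      m = lowest x (rest P)
      split : SplitAt (pathWalk P) m → PivotSplit L x v r
      split s with walkToPath (SplitAt.before s) | walkToPath (SplitAt.after s)
      ... | within P₁ P₁≤ P₁⊆ | within P₂ P₂≤ P₂⊆ = record
        { pivot = m ; a = pathLength P₁ ; b = pathLength P₂
        ; a+b≤r  = ≤-trans (+-mono-≤ P₁≤ P₂≤) (≤-trans (≤-reflexive (SplitAt.lengths s)) P≤r)
        ; first  = P₁ , ≤-refl , anti-mono (SplitAt.before⊆W s ∘ P₁⊆) (lowest-≤ x (rest P))
        ; second = P₂ , ≤-refl , anti-mono (SplitAt.after⊆W s ∘ P₂⊆) (lowest-≤ x (rest P)) }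

members : ∀ {n} {P : Pred (Fin n) 0ℓ} → Decidable P → List (Fin n)
members {n} P? = filter P? (allFin n)

members⁺ : ∀ {n} {P : Pred (Fin n) 0ℓ} (P? : Decidable P) {m} → P m → m ∈ members P?
members⁺ P? {m} = ∈-filter⁺ P? (∈-allFin m)

members⁻ : ∀ {n} {P : Pred (Fin n) 0ℓ} (P? : Decidable P) {m} → m ∈ members P? → P m
members⁻ P? m∈ = proj₂ (∈-filter⁻ P? {xs = allFin _} m∈)

members-length : ∀ {n} {P : Pred (Fin n) 0ℓ} (P? : Decidable P) {S : Fin n → Set} {c} →
                 CardAtMost S c → (∀ {m} → P m → S m) → length (members P?) ≤ c
members-length {n} P? card P⊆S =
  card (members P?) (filter⁺ P? (allFin⁺ n)) (tabulateAll (P⊆S ∘ members⁻ P?))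

length-concatMap : ∀ {A B : Set} (f : A → List B) (xs : List A) {c} →
                   (∀ x → length (f x) ≤ c) → length (concatMap f xs) ≤ length xs * c
length-concatMap f []       f≤c = z≤n
length-concatMap f (x ∷ xs) f≤c =
  ≤-trans (≤-reflexive (length-++ (f x))) (+-mono-≤ (f≤c x) (length-concatMap f xs f≤c))

length-mapWith∈ : ∀ {A B : Set} (xs : List A) (f : ∀ {x} → x ∈ xs → B) →
                  length (mapWith∈ xs f) ≡ length xs
length-mapWith∈ []       f = refl
length-mapWith∈ (x ∷ xs) f = cong suc (length-mapWith∈ xs (f ∘ there))

select : ∀ {n} {P : Pred (Fin n) 0ℓ} → Decidable P → Subset n
select P? = tabulate (does ∘ P?)

∈-select⁺ : ∀ {n} {P : Pred (Fin n) 0ℓ} (P? : Decidable P) {y} → P y → y ∈ₛ select P?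
∈-select⁺ P? {y} Py = lookup⇒[]= y _ (trans (lookup∘tabulate _ y) (dec-true (P? y) Py))

∈-select⁻ : ∀ {n} {P : Pred (Fin n) 0ℓ} (P? : Decidable P) {y} → y ∈ₛ select P? → P y
∈-select⁻ P? {y} y∈ =
  invert (subst (Reflects _) (trans (sym (lookup∘tabulate _ y)) ([]=⇒lookup y∈)) (proof (P? y)))

enumerate : ∀ {n} (p : Subset n) → Fin ∣ p ∣ → Fin n
enumerate (inside  ∷ p) zero    = zero
enumerate (inside  ∷ p) (suc i) = suc (enumerate p i)
enumerate (outside ∷ p) i       = suc (enumerate p i)

enumerate-∈ : ∀ {n} (p : Subset n) i → enumerate p i ∈ₛ p
enumerate-∈ (inside  ∷ p) zero    = Vec.here
enumerate-∈ (inside  ∷ p) (suc i) = Vec.there (enumerate-∈ p i)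
enumerate-∈ (outside ∷ p) i       = Vec.there (enumerate-∈ p i)

enumerate-injective : ∀ {n} (p : Subset n) → Injective _≡_ _≡_ (enumerate p)
enumerate-injective (inside  ∷ p) {zero}  {zero}  _  = refl
enumerate-injective (inside  ∷ p) {suc i} {suc j} eq = cong suc (enumerate-injective p (suc-injective eq))
enumerate-injective (outside ∷ p)                 eq = enumerate-injective p (suc-injective eq)

-- The least b : Fin (suc k) satisfying a decidable predicate (the largest if there is none).
least : ∀ k {Q : Pred (Fin (suc k)) 0ℓ} → Decidable Q → Fin (suc k)
least zero    Q? = zero
least (suc k) Q? with Q? zero
... | yes _ = zero
... | no  _ = suc (least k (Q? ∘ suc))

least-spec : ∀ k {Q : Pred (Fin (suc k)) 0ℓ} (Q? : Decidable Q) {b} → Q b →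
             Q (least k Q?) × toℕ (least k Q?) ≤ toℕ b
least-spec zero    Q? {zero} Qb = Qb , z≤n
least-spec (suc k) Q? {b} Qb with Q? zero
... | yes Q0 = Q0 , z≤n
least-spec (suc k) Q? {zero}  Qb | no ¬Q0 = contradiction Qb ¬Q0
least-spec (suc k) Q? {suc b} Qb | no _   with least-spec k (Q? ∘ suc) Qb
... | Qleast , least≤b = Qleast , s≤s least≤b

¬¬-∀Fin : ∀ k {Q : Fin k → Set} → (∀ i → ¬ ¬ Q i) → ¬ ¬ (∀ i → Q i)
¬¬-∀Fin zero    _   ¬∀ = ¬∀ λ ()
¬¬-∀Fin (suc k) ¬¬Q ¬∀ = ¬¬Q zero λ Q0 → ¬¬-∀Fin k (¬¬Q ∘ suc) λ Qs →
  ¬∀ λ { zero → Q0 ; (suc i) → Qs i }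

-- Lists of length ≤ c over a set A injecting into Fin k, padded with a blank symbol,
-- inject into Fin ((1 + k) ^ c).
module ListCode {A : Set} {k} (enc : A → Fin k) (enc-injective : Injective _≡_ _≡_ enc) where

  encodeList : ∀ c (xs : List A) → length xs ≤ c → Fin (suc k ^ c)
  encodeList zero    []       _       = zero
  encodeList (suc c) []       _       = combine {suc k} zero (encodeList c [] z≤n)
  encodeList (suc c) (x ∷ xs) (s≤s h) = combine {suc k} (suc (enc x)) (encodeList c xs h)

  encodeList-injective : ∀ c {xs ys} p q → encodeList c xs p ≡ encodeList c ys q → xs ≡ ys
  encodeList-injective zero    {[]}     {[]}     _ _ _ = refl
  encodeList-injective (suc c) {[]}     {[]}     _ _ _ = refl
  encodeList-injective (suc c) {[]}     {y ∷ ys} _ (s≤s q) eq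
    with combine-injectiveˡ {suc k} zero (encodeList c [] z≤n) (suc (enc y)) (encodeList c ys q) eq
  ... | ()
  encodeList-injective (suc c) {x ∷ xs} {[]}     (s≤s p) _ eq
    with combine-injectiveˡ {suc k} (suc (enc x)) (encodeList c xs p) zero (encodeList c [] z≤n) eq
  ... | ()
  encodeList-injective (suc c) {x ∷ xs} {y ∷ ys} (s≤s p) (s≤s q) eq
    with combine-injective {suc k} (suc (enc x)) (encodeList c xs p) (suc (enc y)) (encodeList c ys q) eq
  ... | x≡y , xs≡ys =
    cong₂ _∷_ (enc-injective (suc-injective x≡y)) (encodeList-injective c p q xs≡ys)

toSubset : ∀ d → Fin (2 ^ d) → Subset d
toSubset zero    _ = []
toSubset (suc d) i =
  Inverse.to 2↔Bool (proj₁ (remQuot {2} (2 ^ d) i)) ∷ toSubset d (proj₂ (remQuot {2} (2 ^ d) i))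

fromSubset : ∀ {d} → Subset d → Fin (2 ^ d)
fromSubset []      = zero
fromSubset (b ∷ S) = combine {2} (Inverse.from 2↔Bool b) (fromSubset S)

fromSubset∘toSubset : ∀ d i → fromSubset (toSubset d i) ≡ i
fromSubset∘toSubset zero    zero = refl
fromSubset∘toSubset (suc d) i =
  trans (cong₂ (combine {2}) (Inverse.strictlyInverseʳ 2↔Bool (proj₁ (remQuot {2} (2 ^ d) i)))
                             (fromSubset∘toSubset d (proj₂ (remQuot {2} (2 ^ d) i))))
        (combine-remQuot {2} (2 ^ d) i)

subsets≤codes : ∀ {A : Set} {k d c} (enc : A → Fin k) → Injective _≡_ _≡_ enc →
                (F : Subset d → List A) → (∀ S → length (F S) ≤ c) → Injective _≡_ _≡_ F →
                2 ^ d ≤ suc k ^ c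
subsets≤codes {d = d} {c} enc enc-injective F F-short F-injective =
  injective⇒≤ {f = λ i → encodeList c (F (toSubset d i)) (F-short _)} λ {i} {j} eq →
    trans (sym (fromSubset∘toSubset d i))
          (trans (cong fromSubset (F-injective (encodeList-injective c _ _ eq))) (fromSubset∘toSubset d j))
  where open ListCode enc enc-injective

-- Given an order L with |WReach_r[v]| ≤ c for all v, decisions for MinPath with bounds
-- ≤ r, and vertices ξ j, the code of v lists, for each hub m ∈ WReach_r[v], the position
-- of m among the hubs and the least length of a path m → v on which m is L-minimal.
module Encoding {n} (E : Digraph n) (L : LinOrder n) (r c : ℕ)
                (wcol : ∀ v → CardAtMost (WReach E L r v) c)
                (minPath? : ∀ m s t (b : Fin (suc r)) → Dec (MinPath E L m s t (toℕ b)))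
                {d} (ξ : Fin d → Fin n) where

  open Paths E
  open import Data.List.Membership.DecPropositional (_≟ᶠ_ {n}) using (_∈?_)

  minPath≤r? : ∀ m s t → Dec (MinPath E L m s t r)
  minPath≤r? m s t = subst (Dec ∘ MinPath E L m s t) (toℕ-fromℕ r) (minPath? m s t (fromℕ r))

  reachedFrom : Fin n → List (Fin n)
  reachedFrom x = members (λ m → minPath≤r? m x m)

  hub : List (Fin n)
  hub = concatMap (reachedFrom ∘ ξ) (allFin d)

  hub-length : length hub ≤ d * c
  hub-length = ≤-trans (length-concatMap (reachedFrom ∘ ξ) (allFin d) reached≤c)
                       (≤-reflexive (cong (_* c) (length-tabulate {n = d} id)))
    where
    reached≤c : ∀ j → length (reachedFrom (ξ j)) ≤ c
    reached≤c j = members-length _ (wcol (ξ j)) inj₂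

  targets : Fin n → List (Fin n)
  targets v = members (λ m → minPath≤r? m m v ×-dec m ∈? hub)

  target∈hub : ∀ {v m} → m ∈ targets v → m ∈ hub
  target∈hub = proj₂ ∘ members⁻ _

  distance : Fin n → Fin n → Fin (suc r)
  distance v m = least r (minPath? m m v)

  distance-attained : ∀ {v m} → MinPath E L m m v r → MinPath E L m m v (toℕ (distance v m))
  distance-attained {v} {m} mv =
    proj₁ (least-spec r (minPath? m m v) (subst (MinPath E L m m v) (sym (toℕ-fromℕ r)) mv))

  distance-minimal : ∀ {v m b} → b ≤ r → MinPath E L m m v b → toℕ (distance v m) ≤ b
  distance-minimal {v} {m} {b} b≤r mv =
    ≤-trans (proj₂ (least-spec r (minPath? m m v) (subst (MinPath E L m m v) (sym b≡) mv)))
            (≤-reflexive b≡)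
    where
    b≡ : toℕ (fromℕ< (s≤s b≤r)) ≡ b
    b≡ = toℕ-fromℕ< (s≤s b≤r)

  Entry : Set
  Entry = Fin (length hub) × Fin (suc r)

  code : Fin n → List Entry
  code v = mapWith∈ (targets v) λ {m} m∈ → index (target∈hub m∈) , distance v m

  code-length : ∀ v → length (code v) ≤ c
  code-length v = ≤-trans (≤-reflexive (length-mapWith∈ (targets v) _))
                          (members-length _ (wcol v) (inj₁ ∘ proj₁))

  Hit : List Entry → Fin n → Set
  Hit cs x = ∃[ i ] ∃[ β ] ((i , β) ∈ cs × InNbr⁻ E (r ∸ toℕ β) (lookup hub i) x)

  hit-sound : ∀ v x → Hit (code v) x → InNbr⁻ E r v x
  hit-sound v x (i , β , iβ∈ , x→hub) with mapWith∈⁻ (targets v) _ iβ∈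
  ... | m , m∈ , refl =
    inNbr-mono (≤-reflexive (m∸n+n≡m (toℕ≤pred[n] (distance v m))))
               (inNbr-trans x→m (minPath⇒inNbr L m (distance-attained (proj₁ (members⁻ _ m∈)))))
    where
    x→m : InNbr⁻ E (r ∸ toℕ (distance v m)) m x
    x→m = subst (λ w → InNbr⁻ E (r ∸ toℕ (distance v m)) w x)
                (sym (lookup-index (target∈hub m∈))) x→hub

  -- Completeness needs x = ξ j: the pivot of a path ξ j → v is then a hub.
  hit-complete : ∀ v j → InNbr⁻ E r v (ξ j) → Hit (code v) (ξ j)
  hit-complete v j ξj→v =
    index (target∈hub m∈) , distance v m , mapWith∈⁺ _ (m , m∈ , refl) ,
    subst (λ w → InNbr⁻ E (r ∸ toℕ (distance v m)) w (ξ j)) (lookup-index (target∈hub m∈))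
          (inNbr-mono a≤r∸δ (minPath⇒inNbr L m first))
    where
    open PivotSplit (minSplit L ξj→v) renaming (pivot to m)
    a≤r : a ≤ r
    a≤r = m+n≤o⇒m≤o a a+b≤r
    b≤r : b ≤ r
    b≤r = m+n≤o⇒n≤o a a+b≤r
    m∈hub : m ∈ hub
    m∈hub = ∈-concatMap⁺ (reachedFrom ∘ ξ) (lose (∈-allFin j) (members⁺ _ (minPath-mono L m a≤r first)))
    m∈ : m ∈ targets v
    m∈ = members⁺ _ (minPath-mono L m b≤r second , m∈hub)
    a≤r∸δ : a ≤ r ∸ toℕ (distance v m)
    a≤r∸δ = m+n≤o⇒m≤o∸n a (≤-trans (+-monoʳ-≤ a (distance-minimal b≤r second)) a+b≤r)

module Traces {n} (E : Digraph n) (r : ℕ) (X : Subset n) (shattered : Shattered E r X)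
              {d} (ξ : Fin d → Fin n) (ξ-injective : Injective _≡_ _≡_ ξ)
              (ξ∈X : ∀ j → ξ j ∈ₛ X) where

  InImage : Subset d → Fin n → Set
  InImage S y = ∃ λ j → ξ j ≡ y × j ∈ₛ S

  inImage? : ∀ S → Decidable (InImage S)
  inImage? S y = any? λ j → (ξ j ≟ᶠ y) ×-dec (j ∈ₛ? S)

  image : Subset d → Subset n
  image S = select (inImage? S)

  image⊆X : ∀ S → image S ⊆ₛ X
  image⊆X S y∈ with ∈-select⁻ (inImage? S) y∈
  ... | j , refl , _ = ξ∈X j

  cutter : Subset d → Fin n
  cutter S = proj₁ (shattered (image S) (image⊆X S))

  cutter-in : ∀ {S j} → j ∈ₛ S → InNbr⁻ E r (cutter S) (ξ j)
  cutter-in {S} {j} j∈S =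
    proj₁ (proj₂ (shattered (image S) (image⊆X S)) (ξ j) (ξ∈X j))
          (∈-select⁺ (inImage? S) (j , refl , j∈S))

  cutter-out : ∀ {S j} → InNbr⁻ E r (cutter S) (ξ j) → j ∈ₛ S
  cutter-out {S} {j} ξj→cutter
    with ∈-select⁻ (inImage? S)
           (proj₂ (proj₂ (shattered (image S) (image⊆X S)) (ξ j) (ξ∈X j)) ξj→cutter)
  ... | i , ξi≡ξj , i∈S = subst (_∈ₛ S) (ξ-injective ξi≡ξj) i∈S

  cutterCode-injective : ∀ {C : Set} (code : Fin n → C) (Hit : C → Fin n → Set) →
                         (∀ v x → Hit (code v) x → InNbr⁻ E r v x) →
                         (∀ v j → InNbr⁻ E r v (ξ j) → Hit (code v) (ξ j)) →
                         Injective _≡_ _≡_ (code ∘ cutter)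
  cutterCode-injective code Hit sound complete eq = ⊆-antisym (covered eq) (covered (sym eq))
    where
    covered : ∀ {S S′} → code (cutter S) ≡ code (cutter S′) → S ⊆ₛ S′
    covered eq j∈S =
      cutter-out (sound _ _ (subst (λ cv → Hit cv _) eq (complete _ _ (cutter-in j∈S))))

shattered-family : ∀ {n} (E : Digraph n) (L : LinOrder n) (r c : ℕ) →
                   (∀ v → CardAtMost (WReach E L r v) c) →
                   (∀ m s t (b : Fin (suc r)) → Dec (MinPath E L m s t (toℕ b))) →
                   ∀ X → Shattered E r X →
                   ∀ {d} (ξ : Fin d → Fin n) → Injective _≡_ _≡_ ξ → (∀ j → ξ j ∈ₛ X) →
                   2 ^ d ≤ suc (d * c * suc r) ^ c
shattered-family E L r c wcol minPath? X shattered {d} ξ ξ-injective ξ∈X = begin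
  2 ^ d                        ≤⟨ subsets≤codes (uncurry combine) combine-injective′ (code ∘ cutter)
                                    (code-length ∘ cutter)
                                    (cutterCode-injective code Hit hit-sound hit-complete) ⟩
  suc (length hub * suc r) ^ c ≤⟨ ^-monoˡ-≤ c (s≤s (*-monoˡ-≤ (suc r) hub-length)) ⟩
  suc (d * c * suc r) ^ c      ∎
  where
  open ≤-Reasoning
  open Encoding E L r c wcol minPath? ξ
  open Traces E r X shattered ξ ξ-injective ξ∈X
  combine-injective′ : Injective _≡_ _≡_ (uncurry (combine {length hub} {suc r}))
  combine-injective′ {i , β} {i′ , β′} eq with combine-injective i β i′ β′ eq
  ... | refl , refl = refl

vcBound : ℕ → ℕ → ℕ
vcBound r c = (r + 2) * ((2 * c) ^ 2)

cubic≤16^ : ∀ t → 1 + (1 + 4 * t * t) * t ≤ 16 ^ t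
cubic≤16^ 0 = s≤s z≤n
cubic≤16^ 1 = m≤m+n 6 10
cubic≤16^ (suc (suc s)) =
  ≤-trans (≤-trans (m≤m+n _ _) (≤-reflexive (sym (growth s)))) (*-monoʳ-≤ 16 (cubic≤16^ (suc s)))
  where
  growth : ∀ s → 16 * (1 + (1 + 4 * (1 + s) * (1 + s)) * (1 + s))
               ≡ (1 + (1 + 4 * (2 + s) * (2 + s)) * (2 + s)) + (60 * s * s * s + 168 * s * s + 159 * s + 61)
  growth = solve-∀

codes<subsets : ∀ r c → suc (suc (vcBound r c) * c * suc r) ^ c < 2 ^ suc (vcBound r c)
codes<subsets r c = begin-strict
  suc (suc B * c * suc r) ^ c ≤⟨ ^-monoˡ-≤ c (≤-trans (s≤s K≤) (cubic≤16^ t)) ⟩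
  (16 ^ t) ^ c                ≡⟨ ^-*-assoc 16 t c ⟩
  16 ^ (t * c)                ≡⟨ ^-*-assoc 2 4 (t * c) ⟩
  2 ^ (4 * (t * c))           ≡⟨ cong (2 ^_) (sym B≡) ⟩
  2 ^ B                       <⟨ ^-monoʳ-< 2 (s≤s (s≤s z≤n)) (n<1+n B) ⟩
  2 ^ suc B                   ∎
  where
  open ≤-Reasoning
  B t : ℕ
  B = vcBound r c
  t = c * (2 + r)
  B≡ : B ≡ 4 * (t * c)
  B≡ = bound≡ r c
    where
    bound≡ : ∀ r c → (r + 2) * ((2 * c) * ((2 * c) * 1)) ≡ 4 * (c * (2 + r) * c)
    bound≡ = solve-∀
  K≤ : suc B * c * suc r ≤ (1 + 4 * t * t) * t
  K≤ = begin
    suc B * c * suc r   ≡⟨ *-assoc (suc B) c (suc r) ⟩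
    suc B * (c * suc r) ≤⟨ *-mono-≤ (s≤s B≤) (*-monoʳ-≤ c (n≤1+n (suc r))) ⟩
    (1 + 4 * t * t) * t ∎
    where
    B≤ : B ≤ 4 * t * t
    B≤ = begin
      B           ≡⟨ B≡ ⟩
      4 * (t * c) ≡⟨ *-assoc 4 t c ⟨
      4 * t * c   ≤⟨ *-monoʳ-≤ (4 * t) (m≤m*n c (2 + r)) ⟩
      4 * t * t   ∎

minPaths-decidable : ∀ {n} (E : Digraph n) (L : LinOrder n) r →
                     ¬ ¬ (∀ m s t (b : Fin (suc r)) → Dec (MinPath E L m s t (toℕ b)))
minPaths-decidable {n} E L r =
  ¬¬-∀Fin n λ m → ¬¬-∀Fin n λ s → ¬¬-∀Fin n λ t → ¬¬-∀Fin (suc r) λ b → ¬¬-excluded-middle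

mainTheorem5 : ∀ {n} (E : Digraph n) (r : ℕ) → 1 ≤ r → ∀ (c : ℕ) → WcolAtMost E r c →
                 ∀ (X : Subset n) → Shattered E r X → ∣ X ∣ ≤ (r + 2) * ((2 * c) ^ 2)
-- If |X| exceeded the bound, the first bound + 1 elements of X would form a shattered
-- family contradicting codes<subsets.
mainTheorem5 E r _ c (L , wcol) X shattered =
  decidable-stable (∣ X ∣ ≤? vcBound r c) λ X≰bound →
    minPaths-decidable E L r λ minPath? →
      let large = ≰⇒> X≰bound
          ξ     = λ i → enumerate X (inject≤ i large)
      in <⇒≱ (codes<subsets r c)
             (shattered-family E L r c wcol minPath? X shattered ξ
               (inject≤-injective large large _ _ ∘ enumerate-injective X)
               (λ i → enumerate-∈ X (inject≤ i large)))
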